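{- If $\langle A,\rightarrow,\top\rangle$ is a BCI-algebra, then $\langle A,\rightarrow,\rightarrow,\top\rangle$ is a Semi-BCI algebra. Likewise, if $\langle A,\rightarrow,\top\rangle$ is a BCK-algebra, then $\langle A,\rightarrow,\rightarrow,\top\rangle$ is a Semi-BCK algebra.
   Context: A BCI-algebra is a structure $\langle A,\rightarrow,\top\rangle$ such that for all $x,y,z\in A$: (C1) $(y\rightarrow z)\rightarrow((z\rightarrow x)\rightarrow(y\rightarrow x))=\top$; (C2) $x\rightarrow((x\rightarrow y)\rightarrow y)=\top$; (C3) $x\rightarrow x=\top$; (C4) $x\rightarrow y=\top$ and $y\rightarrow x=\top$ imply $x=y$; it is a BCK-algebra if moreover $x\rightarrow\top=\top$ for all $x$. A Semi-BCI (SBCI) algebra is a structure $\langle A,\twoheadrightarrow,\rightarrow,\top\rangle$ with two binary operations and $\top\in A$, where $x\ll y$ iff $x\twoheadrightarrow y=\top$ and $x\preceq y$ iff $x\rightarrow y=\top$, such that for all $x,y,z$: (S1) $x\twoheadrightarrow(y\twoheadrightarrow z)=y\twoheadrightarrow(x\twoheadrightarrow z)$; (S2) $x\rightarrow(y\rightarrow z)=y\rightarrow(x\rightarrow z)$; (S3) $x\twoheadrightarrow y\preceq(z\twoheadrightarrow x)\rightarrow(z\twoheadrightarrow y)$; (S4) $\top\twoheadrightarrow x=x$; (S5) if $x\ll y\preceq z$ then $x\ll z$; (S6) if $x\preceq y\ll z$ then $x\ll z$; (S7) if $x\preceq y$ and $y\preceq x$ then $x=y$. A Semi-BCK (SBCK)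 algebra is an SBCI algebra with $x\ll\top$ for all $x\in A$. -}

module Defs where

open import Level using (Level)
open import Data.Product using (_×_)
open import Relation.Binary.PropositionalEquality using (_≡_)

record IsBCI {a : Level} (A : Set a) (_⇒_ : A → A → A) (⊤ : A) : Set a where
  field
    C1 : ∀ x y z → ((y ⇒ z) ⇒ ((z ⇒ x) ⇒ (y ⇒ x))) ≡ ⊤
    C2 : ∀ x y → (x ⇒ ((x ⇒ y) ⇒ y)) ≡ ⊤
    C3 : ∀ x → (x ⇒ x) ≡ ⊤
    C4 : ∀ x y → (x ⇒ y) ≡ ⊤ → (y ⇒ x) ≡ ⊤ → x ≡ y

record IsBCK {a : Level} (A : Set a) (_⇒_ : A → A → A) (⊤ : A) : Set a where
  field
    isBCI : IsBCI A _⇒_ ⊤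
    K : ∀ x → (x ⇒ ⊤) ≡ ⊤

record IsSBCI {a : Level} (A : Set a) (_↠_ : A → A → A) (_⇒_ : A → A → A) (⊤ : A) : Set a where
  _≪_ : A → A → Set a
  x ≪ y = (x ↠ y) ≡ ⊤
  _≼_ : A → A → Set a
  x ≼ y = (x ⇒ y) ≡ ⊤
  field
    S1 : ∀ x y z → (x ↠ (y ↠ z)) ≡ (y ↠ (x ↠ z))
    S2 : ∀ x y z → (x ⇒ (y ⇒ z)) ≡ (y ⇒ (x ⇒ z))
    S3 : ∀ x y z → (x ↠ y) ≼ ((z ↠ x) ⇒ (z ↠ y))
    S4 : ∀ x → (⊤ ↠ x) ≡ x
    S5 : ∀ x y z → x ≪ y → y ≼ z → x ≪ z
    S6 : ∀ x y z → x ≼ y → y ≪ z → x ≪ z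
    S7 : ∀ x y → x ≼ y → y ≼ x → x ≡ y

record IsSBCK {a : Level} (A : Set a) (_↠_ : A → A → A) (_⇒_ : A → A → A) (⊤ : A) : Set a where
  field
    isSBCI : IsSBCI A _↠_ _⇒_ ⊤
    K : ∀ x → (x ↠ ⊤) ≡ ⊤

-- Write x ≤ y for x ⇒ y ≡ ⊤.  The whole argument lives inside an arbitrary
-- BCI-algebra and derives, from (C1)–(C4), the elementary facts:
--   * ⊤ is a left identity, ⊤ ⇒ x ≡ x (via x ≤ ⊤ ⇒ x and ⊤ ≤ u ⇒ u ≡ ⊤);
--   * ≤ is transitive (from (C1) by discharging two premises ⊤ ⇒ _);
--   * ⇒ is antitone in its first argument;
--   * the exchange law x ⇒ (y ⇒ z) ≡ y ⇒ (x ⇒ z), obtained by proving the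
--     inequality in both directions and applying (C4).
-- With both arrows equal, (S1) and (S2) are exchange, (S3) is (C1) after one
-- exchange, (S4) is the left identity, (S5) and (S6) are transitivity, and
-- (S7) is (C4).
module Submission where

open import Defs
open import Level using (Level)
open import Data.Product using (_×_; _,_)
open import Relation.Binary.PropositionalEquality using (_≡_; sym; trans; subst; subst₂)

module BCIProperties {a : Level} {A : Set a} {_⇒_ : A → A → A} {⊤ : A}
                     (bci : IsBCI A _⇒_ ⊤) where
  open IsBCI bci

  _≤_ : A → A → Set a
  x ≤ y = (x ⇒ y) ≡ ⊤

  ≤-⊤⇒ : ∀ x → x ≤ (⊤ ⇒ x)
  ≤-⊤⇒ x = subst (λ t → x ≤ (t ⇒ x)) (C3 x) (C2 x x)

  ⊤≤⇒≡⊤ : ∀ u → ⊤ ≤ u → u ≡ ⊤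
  ⊤≤⇒≡⊤ u ⊤≤u = C4 u ⊤ u≤⊤ ⊤≤u
    where
    u≤⊤ : u ≤ ⊤
    u≤⊤ = subst (u ≤_) ⊤≤u (≤-⊤⇒ u)

  -- ⊤ is a left identity: ⊤ ⇒ x ≤ x by (C2) at ⊤, and x ≤ ⊤ ⇒ x.
  ⊤⇒-identity : ∀ x → (⊤ ⇒ x) ≡ x
  ⊤⇒-identity x = C4 (⊤ ⇒ x) x (⊤≤⇒≡⊤ _ (C2 ⊤ x)) (≤-⊤⇒ x)

  -- Transitivity: (C1) gives (x ⇒ y) ⇒ ((y ⇒ z) ⇒ (x ⇒ z)) ≡ ⊤, whose two
  -- premises become ⊤ under the hypotheses.
  ≤-trans : ∀ x y z → x ≤ y → y ≤ z → x ≤ z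
  ≤-trans x y z x≤y y≤z = ⊤≤⇒≡⊤ _ (⊤≤⇒≡⊤ _ ⊤≤⊤⇒x⇒z)
    where
    ⊤≤⊤⇒x⇒z : ⊤ ≤ (⊤ ⇒ (x ⇒ z))
    ⊤≤⊤⇒x⇒z = subst₂ (λ s t → s ≤ (t ⇒ (x ⇒ z))) x≤y y≤z (C1 z x y)

  -- ⇒ is antitone in its first argument: (C1) with its first premise
  -- replaced by ⊤, then the left identity.
  ⇒-antitone : ∀ x y z → x ≤ y → (y ⇒ z) ≤ (x ⇒ z)
  ⇒-antitone x y z x≤y = trans (sym (⊤⇒-identity _)) ⊤≤conclusion
    where
    ⊤≤conclusion : ⊤ ≤ ((y ⇒ z) ⇒ (x ⇒ z))
    ⊤≤conclusion = subst (λ s → s ≤ ((y ⇒ z) ⇒ (x ⇒ z))) x≤y (C1 z x y)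

  -- One half of exchange: x ⇒ (y ⇒ z) ≤ ((y ⇒ z) ⇒ z) ⇒ (x ⇒ z) by (C1),
  -- and ((y ⇒ z) ⇒ z) ⇒ (x ⇒ z) ≤ y ⇒ (x ⇒ z) by antitonicity and (C2).
  exchange-≤ : ∀ x y z → (x ⇒ (y ⇒ z)) ≤ (y ⇒ (x ⇒ z))
  exchange-≤ x y z =
    ≤-trans _ _ _ (C1 z x (y ⇒ z)) (⇒-antitone y ((y ⇒ z) ⇒ z) (x ⇒ z) (C2 y z))

  exchange : ∀ x y z → (x ⇒ (y ⇒ z)) ≡ (y ⇒ (x ⇒ z))
  exchange x y z = C4 _ _ (exchange-≤ x y z) (exchange-≤ y x z)

  suffixing : ∀ x y z → (x ⇒ y) ≤ ((z ⇒ x) ⇒ (z ⇒ y))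
  suffixing x y z = trans (exchange (x ⇒ y) (z ⇒ x) (z ⇒ y)) (C1 y z x)

  isSBCI : IsSBCI A _⇒_ _⇒_ ⊤
  isSBCI = record
    { S1 = exchange
    ; S2 = exchange
    ; S3 = suffixing
    ; S4 = ⊤⇒-identity
    ; S5 = ≤-trans
    ; S6 = ≤-trans
    ; S7 = C4
    }

BCK⇒SBCK : ∀ {a : Level} {A : Set a} {_⇒_ : A → A → A} {⊤ : A} →
  IsBCK A _⇒_ ⊤ → IsSBCK A _⇒_ _⇒_ ⊤
BCK⇒SBCK bck = record
  { isSBCI = BCIProperties.isSBCI (IsBCK.isBCI bck)
  ; K      = IsBCK.K bck
  }

corollary3 : ∀ {a : Level} (A : Set a) (_⇒_ : A → A → A) (⊤ : A) →
    (IsBCI A _⇒_ ⊤ → IsSBCI A _⇒_ _⇒_ ⊤) × (IsBCK A _⇒_ ⊤ → IsSBCK A _⇒_ _⇒_ ⊤)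
corollary3 A _⇒_ ⊤ = BCIProperties.isSBCI , BCK⇒SBCK
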